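{- For $n\ge2$, let $Q_1^{\mathrm{ext}}(n)$ be the total, over all $\pi\in\mathrm{Av}_n(213)$, of the number of degree-$1$ vertices of the grid graph $G_\pi$ lying in the first column or in the last column (i.e. vertices $(1,s)$ or $(n,s)$). Then $Q_1^{\mathrm{ext}}(n)=4C_{n-1}$, where $C_k=\frac{1}{k+1}\binom{2k}{k}$.
   Context: The grid graph $G_\pi$ of a permutation $\pi=\pi_1\cdots\pi_n$ of $[n]$ has vertex set $\{(i,j):1\le i\le n,\ 1\le j\le \pi_i\}$; two vertices $(i,j),(i',j')$ are adjacent iff either $i=i'$ and $|j-j'|=1$, or $|i-i'|=1$ and $j=j'$. $\mathrm{Av}_n(213)$ is the set of permutations of $[n]$ with no $p<q<r$ such that $\pi_q<\pi_p<\pi_r$. -}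

module Defs where

open import Data.Nat using (ℕ; zero; suc; _+_; _*_; _∸_; _≤_; _<_; _≤?_; _<?_; _≟_)
open import Data.Nat.Combinatorics using (_C_)
open import Data.Nat.DivMod using (_/_)
open import Data.List using (List; []; _∷_; map; concatMap; filter; length; applyUpTo)
open import Data.Nat.ListAction using (sum)
open import Data.List.Relation.Unary.All using (All; all?)
open import Data.List.Relation.Unary.Unique.Propositional using (Unique)
open import Data.List.Relation.Unary.Unique.DecPropositional _≟_ using (unique?)
open import Data.Product using (_×_; _,_; proj₁; proj₂)
open import Data.Sum using (_⊎_)
open import Relation.Nullary using (Dec; ¬_; _×-dec_; _⊎-dec_; ¬?)
open import Relation.Binary.PropositionalEquality using (_≡_)

range : ℕ → List ℕ
range n = applyUpTo suc n

-- a word π = π₁⋯πₙ is a list; entry i (1-indexed), 0 if out of range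
entry : List ℕ → ℕ → ℕ
entry []       _             = 0
entry (x ∷ xs) zero          = 0
entry (x ∷ xs) (suc zero)    = x
entry (x ∷ xs) (suc (suc i)) = entry xs (suc i)

words : ℕ → ℕ → List (List ℕ)
words n zero    = [] ∷ []
words n (suc k) = concatMap (λ w → map (λ a → a ∷ w) (range n)) (words n k)

IsPerm : ℕ → List ℕ → Set
IsPerm n π = length π ≡ n × (All (λ a → 1 ≤ a × a ≤ n) π × Unique π)

Pattern213At : List ℕ → ℕ × ℕ × ℕ → Set
Pattern213At π (p , q , r) =
  p < q × q < r × entry π q < entry π p × entry π p < entry π r

triples : ℕ → List (ℕ × ℕ × ℕ)
triples n = concatMap (λ p → concatMap (λ q → map (λ r → p , q , r) (range n)) (range n)) (range n)

Avoids213 : ℕ → List ℕ → Set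
Avoids213 n π = All (λ t → ¬ Pattern213At π t) (triples n)

InAv213 : ℕ → List ℕ → Set
InAv213 n π = IsPerm n π × Avoids213 n π

inAv213? : (n : ℕ) (π : List ℕ) → Dec (InAv213 n π)
inAv213? n π =
  ((length π ≟ n) ×-dec (all? (λ a → (1 ≤? a) ×-dec (a ≤? n)) π ×-dec unique? π))
  ×-dec all? (λ { (p , q , r) → ¬? ((p <? q) ×-dec ((q <? r) ×-dec
          ((entry π q <? entry π p) ×-dec (entry π p <? entry π r)))) }) (triples n)

-- Av_n(213) as a list (each permutation listed exactly once)
Av213 : ℕ → List (List ℕ)
Av213 n = filter (inAv213? n) (words n n)

-- grid graph G_π: vertices (i,j) with 1 ≤ i ≤ n, 1 ≤ j ≤ π_i
vertices : ℕ → List ℕ → List (ℕ × ℕ)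
vertices n π = concatMap (λ i → map (λ j → i , j) (range (entry π i))) (range n)

Dist1 : ℕ → ℕ → Set
Dist1 a b = suc a ≡ b ⊎ suc b ≡ a

Adjacent : ℕ × ℕ → ℕ × ℕ → Set
Adjacent (i , j) (i' , j') = (i ≡ i' × Dist1 j j') ⊎ (Dist1 i i' × j ≡ j')

dist1? : (a b : ℕ) → Dec (Dist1 a b)
dist1? a b = (suc a ≟ b) ⊎-dec (suc b ≟ a)

adjacent? : (u v : ℕ × ℕ) → Dec (Adjacent u v)
adjacent? (i , j) (i' , j') = ((i ≟ i') ×-dec dist1? j j') ⊎-dec (dist1? i i' ×-dec (j ≟ j'))

degree : ℕ → List ℕ → ℕ × ℕ → ℕ
degree n π v = length (filter (adjacent? v) (vertices n π))

ExtLeaf : ℕ → List ℕ → ℕ × ℕ → Set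
ExtLeaf n π v = degree n π v ≡ 1 × (proj₁ v ≡ 1 ⊎ proj₁ v ≡ n)

extLeaf? : (n : ℕ) (π : List ℕ) (v : ℕ × ℕ) → Dec (ExtLeaf n π v)
extLeaf? n π v = (degree n π v ≟ 1) ×-dec ((proj₁ v ≟ 1) ⊎-dec (proj₁ v ≟ n))

Q1ext : ℕ → ℕ
Q1ext n = sum (map (λ π → length (filter (extLeaf? n π) (vertices n π))) (Av213 n))

catalan : ℕ → ℕ
catalan k = ((2 * k) C k) / suc k

-- In G_π every column is a path standing on the bottom row. A vertex of the first (or last)
-- column below the top has a vertex above it and one below it or beside it, so only the top
-- vertex can be a leaf, and it is one exactly when the column has height 1 or is taller than
-- its only neighbouring column. Hence Q₁ᵉˣᵗ(n) is the sum over Av_n(213) of the four statistics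
-- [π₁ = 1], [π₂ < π₁], [π_n = 1] and [π_{n-1} < π_n]. A 213-avoider of [n+1] starting with
-- j+1 is (j+1)·(a+j+1)·b with a, b 213-avoiders of sizes n-j and j; in this decomposition the
-- first two statistics only see the cases j = 0 and j = n, while the last two satisfy the
-- Catalan recurrence. Each sums to C_{n-1}, where Catalan numbers come from the ballot table
-- and its reflection identity gives C(2k,k)/(k+1).

module Submission where

open import Level using (Level)
open import Function using (_∘_; _⇔_; mk⇔)
open import Data.Empty using (⊥; ⊥-elim)
open import Data.Product using (∃; _×_; _,_; proj₁; proj₂)
open import Data.Maybe.Relation.Unary.All as Maybe using (just)
open import Data.Sum using (_⊎_; inj₁; inj₂; [_,_])
open import Relation.Nullary using (Dec; yes; no; ¬_)
open import Relation.Nullary.Decidable using (_⊎-dec_)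
open import Relation.Unary using (Pred; Decidable)
open import Relation.Binary.PropositionalEquality hiding ([_])

open import Data.Nat
open import Data.Nat.Properties
open import Data.Nat.Combinatorics using (_C_; nCk+nC[k+1]≡[n+1]C[k+1]; k>n⇒nCk≡0; nCk≡nC[n∸k]; nC1≡n)
open import Data.Nat.DivMod using (_/_; m*n/n≡m)
open import Data.Nat.Induction using (<-rec)
open import Data.Nat.ListAction using (sum)
open import Data.Nat.ListAction.Properties using (sum-++; sum-↭)
open import Algebra.Properties.CommutativeSemigroup +-commutativeSemigroup using (interchange; xy∙z≈xz∙y)

open import Data.List using (List; []; _∷_; map; concatMap; filter; length; _++_; upTo; take; drop; head; takeWhile; dropWhile)
import Data.List.Properties as List
open import Data.List.Membership.Propositional using (_∈_; find; lose)
open import Data.List.Relation.Unary.Any using (here; there)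
open import Data.List.Membership.Propositional.Properties
open import Data.List.Membership.Propositional.Properties.WithK using (unique∧set⇒bag)
open import Data.List.Relation.Unary.All using (All; []; _∷_)
import Data.List.Relation.Unary.All as All
import Data.List.Relation.Unary.All.Properties as All
open import Data.List.Relation.Unary.Unique.Propositional using (Unique; []; _∷_)
import Data.List.Relation.Unary.Unique.Propositional.Properties as Unique
open import Data.List.Relation.Binary.BagAndSetEquality using (∼bag⇒↭)
import Data.List.Relation.Binary.Permutation.Propositional.Properties as ↭

open import Defs

private variable
  ℓ ℓ′ : Level
  A : Set ℓ
  B : Set ℓ′

𝟙 : {P : Set ℓ} → Dec P → ℕ
𝟙 (yes _) = 1
𝟙 (no _)  = 0

𝟙-yes : {P : Set ℓ} (d : Dec P) → P → 𝟙 d ≡ 1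
𝟙-yes (yes _) _ = refl
𝟙-yes (no ¬p) p = ⊥-elim (¬p p)

𝟙-no : {P : Set ℓ} (d : Dec P) → ¬ P → 𝟙 d ≡ 0
𝟙-no (yes p) ¬p = ⊥-elim (¬p p)
𝟙-no (no _)  _  = refl

𝟙-cong : {P : Set ℓ} {Q : Set ℓ′} (d : Dec P) (e : Dec Q) → (P → Q) → (Q → P) → 𝟙 d ≡ 𝟙 e
𝟙-cong (yes p) e       p⇒q _   = sym (𝟙-yes e (p⇒q p))
𝟙-cong (no ¬p) (yes q) _   q⇒p = ⊥-elim (¬p (q⇒p q))
𝟙-cong (no _)  (no _)  _   _   = refl

𝟙-⊎ : {P : Set ℓ} {Q : Set ℓ′} (d : Dec P) (e : Dec Q) → (P → Q → ⊥) → 𝟙 (d ⊎-dec e) ≡ 𝟙 d + 𝟙 e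
𝟙-⊎ (yes p) (yes q) disjoint = ⊥-elim (disjoint p q)
𝟙-⊎ (yes _) (no _)  _        = refl
𝟙-⊎ (no _)  (yes _) _        = refl
𝟙-⊎ (no _)  (no _)  _        = refl

length-filter : {P : Pred A ℓ′} (P? : Decidable P) (xs : List A) →
                length (filter P? xs) ≡ sum (map (𝟙 ∘ P?) xs)
length-filter P? []       = refl
length-filter P? (x ∷ xs) with P? x
... | yes _ = cong suc (length-filter P? xs)
... | no _  = length-filter P? xs

sum-cong : {f g : A → ℕ} (xs : List A) → (∀ {x} → x ∈ xs → f x ≡ g x) →
           sum (map f xs) ≡ sum (map g xs)
sum-cong []       eq = refl
sum-cong (x ∷ xs) eq = cong₂ _+_ (eq (here refl)) (sum-cong xs (eq ∘ there))

sum-const : (c : ℕ) (xs : List A) → sum (map (λ _ → c) xs) ≡ c * length xs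
sum-const c []       = sym (*-zeroʳ c)
sum-const c (_ ∷ xs) = trans (cong (c +_) (sum-const c xs)) (sym (*-suc c (length xs)))

sum-zero : {f : A → ℕ} (xs : List A) → (∀ {x} → x ∈ xs → f x ≡ 0) → sum (map f xs) ≡ 0
sum-zero xs eq = trans (sum-cong xs eq) (sum-const 0 xs)

sum-+ : (f g : A → ℕ) (xs : List A) →
        sum (map (λ x → f x + g x) xs) ≡ sum (map f xs) + sum (map g xs)
sum-+ f g []       = refl
sum-+ f g (x ∷ xs) = trans (cong (f x + g x +_) (sum-+ f g xs))
                           (interchange (f x) (g x) (sum (map f xs)) (sum (map g xs)))

sum-concatMap : (f : B → ℕ) (g : A → List B) (xs : List A) →
                sum (map f (concatMap g xs)) ≡ sum (map (λ x → sum (map f (g x))) xs)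
sum-concatMap f g []       = refl
sum-concatMap f g (x ∷ xs) = begin
  sum (map f (g x ++ concatMap g xs))            ≡⟨ cong sum (List.map-++ f (g x) _) ⟩
  sum (map f (g x) ++ map f (concatMap g xs))    ≡⟨ sum-++ (map f (g x)) _ ⟩
  sum (map f (g x)) + sum (map f (concatMap g xs)) ≡⟨ cong (sum (map f (g x)) +_) (sum-concatMap f g xs) ⟩
  sum (map f (g x)) + sum (map (λ x → sum (map f (g x))) xs) ∎
  where open ≡-Reasoning

sum-map-∘ : (f : B → ℕ) (g : A → B) (xs : List A) → sum (map f (map g xs)) ≡ sum (map (f ∘ g) xs)
sum-map-∘ f g xs = cong sum (sym (List.map-∘ xs))

sum-single : {f : A → ℕ} {y : A} (xs : List A) → Unique xs → y ∈ xs →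
             (∀ {x} → x ∈ xs → x ≢ y → f x ≡ 0) → sum (map f xs) ≡ f y
sum-single {f = f} (x ∷ xs) (x≢xs ∷ _) (here refl) others =
  trans (cong (f x +_) (sum-zero xs λ x′∈ → others (there x′∈) λ { refl → All.lookup x≢xs x′∈ refl }))
        (+-identityʳ (f x))
sum-single {f = f} (x ∷ xs) (x≢xs ∷ !xs) (there y∈) others =
  trans (cong (_+ sum (map f xs)) (others (here refl) (All.lookup x≢xs y∈)))
        (sum-single xs !xs y∈ (others ∘ there))

sum-pair : {f : A → ℕ} {y z : A} (xs : List A) → Unique xs → y ∈ xs → z ∈ xs → y ≢ z →
           (∀ {x} → x ∈ xs → x ≢ y → x ≢ z → f x ≡ 0) → sum (map f xs) ≡ f y + f z
sum-pair (x ∷ xs) _ (here refl) (here refl) y≢z _ = ⊥-elim (y≢z refl)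
sum-pair {f = f} (x ∷ xs) (x≢xs ∷ !xs) (here refl) (there z∈) _ others =
  cong (f x +_) (sum-single xs !xs z∈ λ w∈ → others (there w∈) λ { refl → All.lookup x≢xs w∈ refl })
sum-pair {f = f} {y} (x ∷ xs) (x≢xs ∷ !xs) (there y∈) (here refl) _ others =
  trans (cong (f x +_) (sum-single xs !xs y∈ λ w∈ w≢y →
           others (there w∈) w≢y λ { refl → All.lookup x≢xs w∈ refl }))
        (+-comm (f x) (f y))
sum-pair {f = f} (x ∷ xs) (x≢xs ∷ !xs) (there y∈) (there z∈) y≢z others =
  cong₂ _+_ (others (here refl) (All.lookup x≢xs y∈) (All.lookup x≢xs z∈))
            (sum-pair xs !xs y∈ z∈ y≢z (others ∘ there))

sum-Unique-sameMembers : (f : A → ℕ) {xs ys : List A} → Unique xs → Unique ys →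
                         (∀ {z} → z ∈ xs ⇔ z ∈ ys) → sum (map f xs) ≡ sum (map f ys)
sum-Unique-sameMembers f !xs !ys same = sum-↭ (↭.map⁺ f (∼bag⇒↭ (unique∧set⇒bag !xs !ys same)))

length-Unique-⊆ : {xs ys : List A} → Unique xs → (∀ {z} → z ∈ xs → z ∈ ys) → length xs ≤ length ys
length-Unique-⊆ {xs = []}     _           _    = z≤n
length-Unique-⊆ {xs = x ∷ xs} (x≢xs ∷ !xs) x∷xs⊆ys
  with ys₁ , ys₂ , refl ← ∈-∃++ (x∷xs⊆ys (here refl)) = begin
    suc (length xs)               ≤⟨ s≤s (length-Unique-⊆ !xs xs⊆ys₁ys₂) ⟩
    suc (length (ys₁ ++ ys₂))     ≡⟨ ↭.↭-length (↭.shift x ys₁ ys₂) ⟨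
    length (ys₁ ++ x ∷ ys₂)       ∎
  where
  open ≤-Reasoning
  xs⊆ys₁ys₂ : ∀ {z} → z ∈ xs → z ∈ ys₁ ++ ys₂
  xs⊆ys₁ys₂ z∈ with ↭.∈-resp-↭ (↭.shift x ys₁ ys₂) (x∷xs⊆ys (there z∈))
  ... | here refl = ⊥-elim (All.lookup x≢xs z∈ refl)
  ... | there z∈′ = z∈′

concatMap-Unique : {xs : List A} (f : A → List B) (tag : B → A) → Unique xs →
                   (∀ {x} → x ∈ xs → Unique (f x)) →
                   (∀ {x} → x ∈ xs → ∀ {y} → y ∈ f x → tag y ≡ x) → Unique (concatMap f xs)
concatMap-Unique {xs = []}     f tag _           _      _      = []
concatMap-Unique {xs = x ∷ xs} f tag (x≢xs ∷ !xs) !f tagged =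
  Unique.++⁺ (!f (here refl)) (concatMap-Unique f tag !xs (!f ∘ there) (tagged ∘ there)) disjoint
  where
  disjoint : ∀ {y} → y ∈ f x × y ∈ concatMap f xs → ⊥
  disjoint (y∈fx , y∈fxs) with z , z∈xs , y∈fz ← find (∈-concatMap⁻ f {xs = xs} y∈fxs) =
    All.lookup x≢xs z∈xs (trans (sym (tagged (here refl) y∈fx)) (tagged (there z∈xs) y∈fz))

∑< : ℕ → (ℕ → ℕ) → ℕ
∑< zero    f = 0
∑< (suc n) f = ∑< n f + f n

∑<-cong : ∀ n {f g : ℕ → ℕ} → (∀ k → k < n → f k ≡ g k) → ∑< n f ≡ ∑< n g
∑<-cong zero    eq = refl
∑<-cong (suc n) eq = cong₂ _+_ (∑<-cong n λ k k<n → eq k (m<n⇒m<1+n k<n)) (eq n ≤-refl)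

∑<-zero : ∀ n {f : ℕ → ℕ} → (∀ k → k < n → f k ≡ 0) → ∑< n f ≡ 0
∑<-zero zero    eq = refl
∑<-zero (suc n) eq = cong₂ _+_ (∑<-zero n λ k k<n → eq k (m<n⇒m<1+n k<n)) (eq n ≤-refl)

∑<-+ : ∀ n (f g : ℕ → ℕ) → ∑< n (λ k → f k + g k) ≡ ∑< n f + ∑< n g
∑<-+ zero    f g = refl
∑<-+ (suc n) f g = trans (cong (_+ (f n + g n)) (∑<-+ n f g)) (interchange (∑< n f) (∑< n g) (f n) (g n))

∑<-front : ∀ n (f : ℕ → ℕ) → ∑< (suc n) f ≡ f 0 + ∑< n (f ∘ suc)
∑<-front zero    f = +-comm 0 (f 0)
∑<-front (suc n) f = trans (cong (_+ f (suc n)) (∑<-front n f)) (+-assoc (f 0) _ (f (suc n)))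

∑<-δ : ∀ n (f : ℕ → ℕ) {i} → i < n → ∑< n (λ k → 𝟙 (k ≟ i) * f k) ≡ f i
∑<-δ (suc n) f {i} i<1+n with m≤n⇒m<n∨m≡n (≤-pred i<1+n)
... | inj₁ i<n  = trans (cong₂ _+_ (∑<-δ n f i<n) (cong (_* f n) (𝟙-no (n ≟ i) (>⇒≢ i<n))))
                        (+-identityʳ (f i))
... | inj₂ refl = trans (cong₂ _+_ (∑<-zero n λ k k<i → cong (_* f k) (𝟙-no (k ≟ i) (<⇒≢ k<i)))
                                   (cong (_* f i) (𝟙-yes (i ≟ i) refl)))
                        (+-identityʳ (f i))

sum-upTo : ∀ n (f : ℕ → ℕ) → sum (map f (upTo n)) ≡ ∑< n f
sum-upTo zero    f = refl
sum-upTo (suc n) f = begin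
  sum (map f (upTo (suc n)))            ≡⟨ cong (sum ∘ map f) (List.applyUpTo-∷ʳ (λ k → k) n) ⟨
  sum (map f (upTo n ++ n ∷ []))        ≡⟨ cong sum (List.map-++ f (upTo n) (n ∷ [])) ⟩
  sum (map f (upTo n) ++ f n ∷ [])      ≡⟨ sum-++ (map f (upTo n)) (f n ∷ []) ⟩
  sum (map f (upTo n)) + (f n + 0)      ≡⟨ cong₂ _+_ (sum-upTo n f) (+-identityʳ (f n)) ⟩
  ∑< n f + f n                          ∎
  where open ≡-Reasoning

-- ballot a b counts the words with a letters U and b letters D all of whose prefixes contain
-- at least as many U as D; Cat n = ballot n n counts Dyck words.
ballot : ℕ → ℕ → ℕ
ballot a       zero    = 1
ballot zero    (suc b) = 0
ballot (suc a) (suc b) with b ≤? a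
... | yes _ = ballot a (suc b) + ballot (suc a) b
... | no _  = 0

Cat : ℕ → ℕ
Cat n = ballot n n

ballot-suc : ∀ a b → b ≤ a → ballot (suc a) (suc b) ≡ ballot a (suc b) + ballot (suc a) b
ballot-suc a b b≤a with b ≤? a
... | yes _   = refl
... | no b≰a = ⊥-elim (b≰a b≤a)

ballot-< : ∀ a b → a < b → ballot a b ≡ 0
ballot-< zero    (suc b) _         = refl
ballot-< (suc a) (suc b) (s≤s a<b) with b ≤? a
... | yes b≤a = ⊥-elim (<⇒≱ a<b b≤a)
... | no _    = refl

ballot-convolution : ∀ a b → b ≤ a → ballot (suc a) b ≡ ∑< (suc b) (λ k → Cat k * ballot (a ∸ k) (b ∸ k))
ballot-convolution a       zero    _         = refl
ballot-convolution (suc a) (suc b) (s≤s b≤a) = begin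
  ballot (suc (suc a)) (suc b)
    ≡⟨ ballot-suc (suc a) b (m≤n⇒m≤1+n b≤a) ⟩
  ballot (suc a) (suc b) + ballot (suc (suc a)) b
    ≡⟨ cong₂ _+_ first-step-up (ballot-convolution (suc a) b (m≤n⇒m≤1+n b≤a)) ⟩
  (∑< (suc b) up + term (suc b)) + ∑< (suc b) down
    ≡⟨ xy∙z≈xz∙y (∑< (suc b) up) (term (suc b)) (∑< (suc b) down) ⟩
  ∑< (suc b) up + ∑< (suc b) down + term (suc b)
    ≡⟨ cong (_+ term (suc b)) (∑<-+ (suc b) up down) ⟨
  ∑< (suc b) (λ k → up k + down k) + term (suc b)
    ≡⟨ cong (_+ term (suc b)) (∑<-cong (suc b) up+down) ⟩
  ∑< (suc (suc b)) term ∎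
  where
  open ≡-Reasoning
  term up down : ℕ → ℕ
  term k = Cat k * ballot (suc a ∸ k) (suc b ∸ k)
  up   k = Cat k * ballot (a ∸ k) (suc b ∸ k)
  down k = Cat k * ballot (suc a ∸ k) (b ∸ k)
  Cat≡last : ∀ c → Cat (suc b) ≡ Cat (suc b) * ballot c (b ∸ b)
  Cat≡last c rewrite n∸n≡0 b = sym (*-identityʳ (Cat (suc b)))
  first-step-up : ballot (suc a) (suc b) ≡ ∑< (suc b) up + term (suc b)
  first-step-up with m≤n⇒m<n∨m≡n b≤a
  ... | inj₁ b<a  = trans (ballot-convolution a (suc b) b<a)
                          (cong (∑< (suc b) up +_) (trans (sym (Cat≡last (a ∸ suc b))) (Cat≡last (a ∸ b))))
  ... | inj₂ refl = sym (cong₂ _+_ (∑<-zero (suc b) up≡0) (sym (Cat≡last (b ∸ b))))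
    where
    up≡0 : ∀ k → k < suc b → up k ≡ 0
    up≡0 k (s≤s k≤b) rewrite +-∸-assoc 1 k≤b | ballot-< (b ∸ k) (suc (b ∸ k)) ≤-refl = *-zeroʳ (Cat k)
  up+down : ∀ k → k < suc b → up k + down k ≡ term k
  up+down k (s≤s k≤b) rewrite +-∸-assoc 1 k≤b | +-∸-assoc 1 (≤-trans k≤b b≤a)
    | ballot-suc (a ∸ k) (b ∸ k) (∸-monoˡ-≤ k b≤a) = sym (*-distribˡ-+ (Cat k) _ _)

Cat-suc : ∀ n → Cat (suc n) ≡ ∑< (suc n) (λ k → Cat k * Cat (n ∸ k))
Cat-suc n = begin
  Cat (suc n)                           ≡⟨ ballot-suc n n ≤-refl ⟩
  ballot n (suc n) + ballot (suc n) n   ≡⟨ cong (_+ ballot (suc n) n) (ballot-< n (suc n) ≤-refl) ⟩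
  ballot (suc n) n                      ≡⟨ ballot-convolution n n ≤-refl ⟩
  ∑< (suc n) (λ k → Cat k * Cat (n ∸ k)) ∎
  where open ≡-Reasoning

ballot-1 : ∀ a → ballot a 1 ≡ a
ballot-1 zero    = refl
ballot-1 (suc a) = trans (ballot-suc a 0 z≤n) (trans (cong (_+ 1) (ballot-1 a)) (+-comm a 1))

ballot-reflection : ∀ a b → b ≤ a → ballot a (suc b) + (a + suc b) C b ≡ (a + suc b) C suc b
ballot-reflection a zero _ = trans (cong (_+ 1) (ballot-1 a)) (sym (nC1≡n (a + 1)))
ballot-reflection (suc a) (suc b) (s≤s b≤a) with m≤n⇒m<n∨m≡n b≤a
... | inj₁ b<a = begin
  ballot (suc a) (suc (suc b)) + suc m C suc b
    ≡⟨ cong₂ _+_ (ballot-suc a (suc b) b<a) (trans (sym (nCk+nC[k+1]≡[n+1]C[k+1] m b)) (+-comm (m C b) _)) ⟩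
  (ballot a (suc (suc b)) + ballot (suc a) (suc b)) + (m C suc b + m C b)
    ≡⟨ interchange (ballot a (suc (suc b))) _ _ _ ⟩
  (ballot a (suc (suc b)) + m C suc b) + (ballot (suc a) (suc b) + m C b)
    ≡⟨ cong₂ _+_ (ballot-reflection a (suc b) b<a) reflection-below ⟩
  m C suc (suc b) + m C suc b
    ≡⟨ +-comm (m C suc (suc b)) _ ⟩
  m C suc b + m C suc (suc b)
    ≡⟨ nCk+nC[k+1]≡[n+1]C[k+1] m (suc b) ⟩
  suc m C suc (suc b) ∎
  where
  open ≡-Reasoning
  m = a + suc (suc b)
  reflection-below : ballot (suc a) (suc b) + m C b ≡ m C suc b
  reflection-below = subst (λ l → ballot (suc a) (suc b) + l C b ≡ l C suc b) (sym (+-suc a (suc b)))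
                           (ballot-reflection (suc a) b (m≤n⇒m≤1+n b≤a))
... | inj₂ refl = begin
  ballot (suc a) (suc (suc a)) + m C suc a ≡⟨ cong (_+ m C suc a) (ballot-< (suc a) (suc (suc a)) ≤-refl) ⟩
  m C suc a                                ≡⟨ nCk≡nC[n∸k] (m≤m+n (suc a) (suc (suc a))) ⟩
  m C (m ∸ suc a)                          ≡⟨ cong (m C_) (m+n∸m≡n (suc a) (suc (suc a))) ⟩
  m C suc (suc a)                          ∎
  where
  open ≡-Reasoning
  m = suc a + suc (suc a)

[k+1]*nC[k+1]≡[n∸k]*nCk : ∀ n k → suc k * (n C suc k) ≡ (n ∸ k) * (n C k)
[k+1]*nC[k+1]≡[n∸k]*nCk zero    k       = trans (*-zeroʳ (suc k)) (sym (cong (_* (0 C k)) (0∸n≡0 k)))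
[k+1]*nC[k+1]≡[n∸k]*nCk (suc n) zero    = trans (+-identityʳ (suc n C 1)) (trans (nC1≡n (suc n)) (sym (*-identityʳ (suc n))))
[k+1]*nC[k+1]≡[n∸k]*nCk (suc n) (suc k) = begin
  suc (suc k) * (suc n C suc (suc k))    ≡⟨ cong (suc (suc k) *_) (nCk+nC[k+1]≡[n+1]C[k+1] n (suc k)) ⟨
  suc (suc k) * (X + n C suc (suc k))    ≡⟨ *-distribˡ-+ (suc (suc k)) X _ ⟩
  suc (suc k) * X + suc (suc k) * (n C suc (suc k))
                                         ≡⟨ cong (suc (suc k) * X +_) ([k+1]*nC[k+1]≡[n∸k]*nCk n (suc k)) ⟩
  suc (suc k) * X + (n ∸ suc k) * X      ≡⟨ *-distribʳ-+ X (suc (suc k)) (n ∸ suc k) ⟨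
  (suc (suc k) + (n ∸ suc k)) * X        ≡⟨ coefficient ⟩
  (suc k + (n ∸ k)) * X                  ≡⟨ *-distribʳ-+ X (suc k) (n ∸ k) ⟩
  suc k * X + (n ∸ k) * X                ≡⟨ cong (_+ (n ∸ k) * X) ([k+1]*nC[k+1]≡[n∸k]*nCk n k) ⟩
  (n ∸ k) * (n C k) + (n ∸ k) * X        ≡⟨ *-distribˡ-+ (n ∸ k) (n C k) X ⟨
  (n ∸ k) * (n C k + X)                  ≡⟨ cong ((n ∸ k) *_) (nCk+nC[k+1]≡[n+1]C[k+1] n k) ⟩
  (n ∸ k) * (suc n C suc k)              ∎
  where
  open ≡-Reasoning
  X = n C suc k
  coefficient : (suc (suc k) + (n ∸ suc k)) * X ≡ (suc k + (n ∸ k)) * X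
  coefficient with suc k ≤? n
  ... | yes k<n = cong (_* X) (trans (sym (+-suc (suc k) (n ∸ suc k))) (cong (suc k +_) (sym (+-∸-assoc 1 k<n))))
  ... | no k≮n rewrite k>n⇒nCk≡0 (≰⇒> k≮n) =
    trans (*-zeroʳ (suc (suc k) + (n ∸ suc k))) (sym (*-zeroʳ (suc k + (n ∸ k))))

catalan≡Cat : ∀ n → catalan n ≡ Cat n
catalan≡Cat zero    = refl
catalan≡Cat (suc k) = begin
  ((2 * suc k) C suc k) / suc (suc k) ≡⟨ cong (λ l → ((suc k + l) C suc k) / suc (suc k)) (+-identityʳ (suc k)) ⟩
  X / suc (suc k)                      ≡⟨ cong (_/ suc (suc k)) (sym X≡[k+2]*Cat) ⟩
  suc (suc k) * Cat (suc k) / suc (suc k) ≡⟨ cong (_/ suc (suc k)) (*-comm (suc (suc k)) (Cat (suc k))) ⟩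
  Cat (suc k) * suc (suc k) / suc (suc k) ≡⟨ m*n/n≡m (Cat (suc k)) (suc (suc k)) ⟩
  Cat (suc k)                          ∎
  where
  open ≡-Reasoning
  m = suc k + suc k
  X = m C suc k
  Y = m C k
  Cat+Y≡X : Cat (suc k) + Y ≡ X
  Cat+Y≡X = ballot-reflection (suc k) k (n≤1+n k)
  [k+1]*X≡[k+2]*Y : suc k * X ≡ suc (suc k) * Y
  [k+1]*X≡[k+2]*Y = trans ([k+1]*nC[k+1]≡[n∸k]*nCk m k)
                          (cong (_* Y) (trans (cong (_∸ k) (+-suc (suc k) k)) (m+n∸n≡m (suc (suc k)) k)))
  X≡[k+2]*Cat : suc (suc k) * Cat (suc k) ≡ X
  X≡[k+2]*Cat = +-cancelʳ-≡ (suc k * X) (suc (suc k) * Cat (suc k)) X (begin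
    suc (suc k) * Cat (suc k) + suc k * X        ≡⟨ cong (suc (suc k) * Cat (suc k) +_) [k+1]*X≡[k+2]*Y ⟩
    suc (suc k) * Cat (suc k) + suc (suc k) * Y  ≡⟨ *-distribˡ-+ (suc (suc k)) (Cat (suc k)) Y ⟨
    suc (suc k) * (Cat (suc k) + Y)              ≡⟨ cong (suc (suc k) *_) Cat+Y≡X ⟩
    suc (suc k) * X                              ∎)

∈-range⁻ : ∀ {i n} → i ∈ range n → 1 ≤ i × i ≤ n
∈-range⁻ i∈ with _ , k<n , refl ← ∈-applyUpTo⁻ suc i∈ = s≤s z≤n , k<n

∈-range⁺ : ∀ {i n} → 1 ≤ i → i ≤ n → i ∈ range n
∈-range⁺ {suc i} _ i<n = ∈-applyUpTo⁺ suc i<n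

range-Unique : ∀ n → Unique (range n)
range-Unique n = Unique.applyUpTo⁺₁ suc n λ i<j _ → <⇒≢ i<j ∘ suc-injective

length-range : ∀ n → length (range n) ≡ n
length-range = List.length-applyUpTo suc

Letters : ℕ → List ℕ → Set
Letters n = All (λ a → 1 ≤ a × a ≤ n)

∈-words⁻ : ∀ n k {π} → π ∈ words n k → length π ≡ k × Letters n π
∈-words⁻ n zero    (here refl) = refl , []
∈-words⁻ n (suc k) π∈
  with w , w∈ , π∈aw ← find (∈-concatMap⁻ (λ w → map (_∷ w) (range n)) {xs = words n k} π∈)
  with a , a∈ , refl ← ∈-map⁻ (_∷ w) π∈aw
  with |w| , ws ← ∈-words⁻ n k w∈ = cong suc |w| , ∈-range⁻ a∈ ∷ ws

∈-words⁺ : ∀ n k {π} → length π ≡ k → Letters n π → π ∈ words n k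
∈-words⁺ n zero    {[]}    refl []                 = here refl
∈-words⁺ n (suc k) {a ∷ w} |π|  ((1≤a , a≤n) ∷ ws) =
  ∈-concatMap⁺ (λ w → map (_∷ w) (range n))
    (lose (∈-words⁺ n k (suc-injective |π|) ws) (∈-map⁺ (_∷ w) (∈-range⁺ 1≤a a≤n)))

words-Unique : ∀ n k → Unique (words n k)
words-Unique n zero    = [] ∷ []
words-Unique n (suc k) =
  concatMap-Unique (λ w → map (_∷ w) (range n)) (drop 1) (words-Unique n k)
    (λ _ → Unique.map⁺ List.∷-injectiveˡ (range-Unique n)) λ _ π∈ → tail≡ π∈
  where
  tail≡ : ∀ {w π} → π ∈ map (_∷ w) (range n) → drop 1 π ≡ w
  tail≡ π∈ with _ , _ , refl ← ∈-map⁻ _ π∈ = refl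

∈-Av213⁻ : ∀ {n π} → π ∈ Av213 n → InAv213 n π
∈-Av213⁻ {n} π∈ = proj₂ (∈-filter⁻ (inAv213? n) {xs = words n n} π∈)

∈-Av213⁺ : ∀ {n π} → InAv213 n π → π ∈ Av213 n
∈-Av213⁺ {n} π∈@((|π| , letters , _) , _) = ∈-filter⁺ (inAv213? n) (∈-words⁺ n n |π| letters) π∈

Av213-Unique : ∀ n → Unique (Av213 n)
Av213-Unique n = Unique.filter⁺ (inAv213? n) (words-Unique n n)

IsIndex : List ℕ → ℕ → Set
IsIndex π i = 1 ≤ i × i ≤ length π

entry-0 : ∀ π → entry π 0 ≡ 0
entry-0 []      = refl
entry-0 (_ ∷ _) = refl

entry-∷ : ∀ x xs {i} → 1 ≤ i → entry (x ∷ xs) (suc i) ≡ entry xs i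
entry-∷ x xs {suc i} _ = refl

entry->length : ∀ π {i} → length π < i → entry π i ≡ 0
entry->length []      _                    = refl
entry->length (x ∷ π) {suc (suc i)} (s≤s |π|<1+i) = entry->length π |π|<1+i

entry>0⇒IsIndex : ∀ π {i} → 0 < entry π i → IsIndex π i
entry>0⇒IsIndex π {zero}  πi>0 = ⊥-elim (<-irrefl (sym (entry-0 π)) πi>0)
entry>0⇒IsIndex π {suc i} πi>0 with suc i ≤? length π
... | yes i≤|π| = s≤s z≤n , i≤|π|
... | no i≰|π|  = ⊥-elim (<-irrefl (sym (entry->length π (≰⇒> i≰|π|))) πi>0)

entry-∈ : ∀ π {i} → IsIndex π i → entry π i ∈ π
entry-∈ (x ∷ π) {suc zero}    _               = here refl
entry-∈ (x ∷ π) {suc (suc i)} (_ , s≤s i<|π|) = there (entry-∈ π (s≤s z≤n , i<|π|))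

∈⇒entry : ∀ {π x} → x ∈ π → ∃ λ i → IsIndex π i × entry π i ≡ x
∈⇒entry (here refl) = 1 , (s≤s z≤n , s≤s z≤n) , refl
∈⇒entry {_ ∷ π} (there x∈)
  with suc i , (_ , i<|π|) , refl ← ∈⇒entry x∈ = suc (suc i) , (s≤s z≤n , s≤s i<|π|) , refl

entry-++ˡ : ∀ xs ys {i} → i ≤ length xs → entry (xs ++ ys) i ≡ entry xs i
entry-++ˡ []       ys {zero}        _         = entry-0 ys
entry-++ˡ (x ∷ xs) ys {zero}        _         = refl
entry-++ˡ (x ∷ xs) ys {suc zero}    _         = refl
entry-++ˡ (x ∷ xs) ys {suc (suc i)} (s≤s i<) = entry-++ˡ xs ys i<

entry-++ʳ : ∀ xs ys {i} → 1 ≤ i → entry (xs ++ ys) (length xs + i) ≡ entry ys i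
entry-++ʳ []       ys         _ = refl
entry-++ʳ (x ∷ xs) ys {suc i} _ =
  trans (entry-∷ x (xs ++ ys) (≤-trans (s≤s z≤n) (m≤n+m (suc i) (length xs))))
        (entry-++ʳ xs ys (s≤s z≤n))

entry-map : ∀ (f : ℕ → ℕ) a {i} → IsIndex a i → entry (map f a) i ≡ f (entry a i)
entry-map f (x ∷ a) {suc zero}    _               = refl
entry-map f (x ∷ a) {suc (suc i)} (_ , s≤s i<|a|) = entry-map f a (s≤s z≤n , i<|a|)

-- Avoids213 only quantifies over indices in [1, n]; dropping that restriction changes nothing
-- because entry is 0 off the index range, so no 213 occurrence can use such an index.
No213 : List ℕ → Set
No213 π = ∀ {p q r} → ¬ Pattern213At π (p , q , r)

Pattern213At-IsIndex : ∀ π {p q r} → Pattern213At π (p , q , r) → IsIndex π p × IsIndex π q × IsIndex π r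
Pattern213At-IsIndex π (p<q , q<r , πq<πp , πp<πr) =
  (1≤p , ≤-trans (<⇒≤ p<q) q≤|π|) ,
  (≤-trans 1≤p (<⇒≤ p<q) , q≤|π|) ,
  (≤-trans 1≤p (<⇒≤ (<-trans p<q q<r)) , r≤|π|)
  where
  1≤p    = proj₁ (entry>0⇒IsIndex π (≤-trans (s≤s z≤n) πq<πp))
  r≤|π|  = proj₂ (entry>0⇒IsIndex π (≤-trans (s≤s z≤n) πp<πr))
  q≤|π|  = ≤-trans (<⇒≤ q<r) r≤|π|

No213-embedding : ∀ π σ (g : ℕ → ℕ) → (∀ {i j} → i < j → g i < g j) →
                  (∀ {i j} → IsIndex π i → IsIndex π j → entry π i < entry π j → entry σ (g i) < entry σ (g j)) →
                  No213 σ → No213 π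
No213-embedding π σ g g-mono g-pres σ-free pat@(p<q , q<r , πq<πp , πp<πr)
  with ip , iq , ir ← Pattern213At-IsIndex π pat =
  σ-free (g-mono p<q , g-mono q<r , g-pres iq ip πq<πp , g-pres ip ir πp<πr)

No213-∷⁻ : ∀ {x R} → No213 (x ∷ R) → No213 R
No213-∷⁻ {x} {R} = No213-embedding R (x ∷ R) suc s≤s
  λ { {i} {j} (1≤i , _) (1≤j , _) → subst₂ _<_ (sym (entry-∷ x R 1≤i)) (sym (entry-∷ x R 1≤j)) }

No213-++⁻ˡ : ∀ A B → No213 (A ++ B) → No213 A
No213-++⁻ˡ A B = No213-embedding A (A ++ B) (λ i → i) (λ i<j → i<j)
  λ (_ , i≤) (_ , j≤) → subst₂ _<_ (sym (entry-++ˡ A B i≤)) (sym (entry-++ˡ A B j≤))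

No213-++⁻ʳ : ∀ A B → No213 (A ++ B) → No213 B
No213-++⁻ʳ A B = No213-embedding B (A ++ B) (length A +_) (+-monoʳ-< (length A))
  λ (1≤i , _) (1≤j , _) → subst₂ _<_ (sym (entry-++ʳ A B 1≤i)) (sym (entry-++ʳ A B 1≤j))

No213-map⁻ : ∀ (f : ℕ → ℕ) → (∀ {u v} → u < v → f u < f v) → ∀ a → No213 (map f a) → No213 a
No213-map⁻ f f-mono a = No213-embedding a (map f a) (λ i → i) (λ i<j → i<j)
  λ i∈ j∈ lt → subst₂ _<_ (sym (entry-map f a i∈)) (sym (entry-map f a j∈)) (f-mono lt)

No213-map⁺ : ∀ (f : ℕ → ℕ) → (∀ {u v} → f u < f v → u < v) → ∀ a → No213 a → No213 (map f a)
No213-map⁺ f f-reflects a = No213-embedding (map f a) a (λ i → i) (λ i<j → i<j)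
  λ i∈ j∈ lt → f-reflects (subst₂ _<_ (entry-map f a (index i∈)) (entry-map f a (index j∈)) lt)
  where
  index : ∀ {i} → IsIndex (map f a) i → IsIndex a i
  index (1≤i , i≤) = 1≤i , subst (_ ≤_) (List.length-map f a) i≤

NoHead213 : ℕ → List ℕ → Set
NoHead213 x R = ∀ {q r} → 1 ≤ q → q < r → ¬ (entry R q < x × x < entry R r)

No213-∷⁺ : ∀ {x R} → No213 R → NoHead213 x R → No213 (x ∷ R)
No213-∷⁺ _ _ {zero} (_ , _ , πq<0 , _) = n≮0 πq<0
No213-∷⁺ _ _ {suc zero} {suc zero} (s≤s () , _)
No213-∷⁺ _ head-free {suc zero} {suc (suc q)} {suc (suc r)} (_ , s≤s q<r , πq<x , x<πr) =
  head-free (s≤s z≤n) q<r (πq<x , x<πr)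
No213-∷⁺ R-free _ {suc (suc p)} {suc (suc q)} {suc (suc r)} (s≤s p<q , s≤s q<r , πq<πp , πp<πr) =
  R-free (p<q , q<r , πq<πp , πp<πr)

No213⇒NoHead213 : ∀ {x R} → No213 (x ∷ R) → NoHead213 x R
No213⇒NoHead213 free {suc q} {suc r} _ q<r (Rq<x , x<Rr) =
  free {1} {suc (suc q)} {suc (suc r)} (s≤s (s≤s z≤n) , s≤s q<r , Rq<x , x<Rr)

split-IsIndex : ∀ A B {i} → IsIndex (A ++ B) i → length A < i → ∃ λ i′ → IsIndex B i′ × i ≡ length A + i′
split-IsIndex A B {i} (_ , i≤) |A|<i =
  i ∸ length A , (m<n⇒0<n∸m |A|<i , i∸|A|≤|B|) , sym (m+[n∸m]≡n (<⇒≤ |A|<i))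
  where
  i∸|A|≤|B| : i ∸ length A ≤ length B
  i∸|A|≤|B| = begin
    i ∸ length A                         ≤⟨ ∸-monoˡ-≤ (length A) (subst (i ≤_) (List.length-++ A) i≤) ⟩
    length A + length B ∸ length A       ≡⟨ m+n∸m≡n (length A) (length B) ⟩
    length B                             ∎
    where open ≤-Reasoning

No213-++⁺ : ∀ A B → No213 A → No213 B → (∀ {u v} → u ∈ A → v ∈ B → v < u) → No213 (A ++ B)
No213-++⁺ A B A-free B-free B<A {p} {q} {r} pat@(p<q , q<r , πq<πp , πp<πr)
  with ip , iq , ir ← Pattern213At-IsIndex (A ++ B) pat
  with r ≤? length A | p ≤? length A
... | yes r≤|A| | _ =
  A-free (p<q , q<r , subst₂ _<_ (entry-++ˡ A B q≤|A|) (entry-++ˡ A B p≤|A|) πq<πp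
                    , subst₂ _<_ (entry-++ˡ A B p≤|A|) (entry-++ˡ A B r≤|A|) πp<πr)
  where
  q≤|A| = ≤-trans (<⇒≤ q<r) r≤|A|
  p≤|A| = ≤-trans (<⇒≤ p<q) q≤|A|
... | no r≰|A| | yes p≤|A| with r′ , ir′ , refl ← split-IsIndex A B ir (≰⇒> r≰|A|) =
  <-asym (B<A (entry-∈ A (proj₁ ip , p≤|A|)) (entry-∈ B ir′))
         (subst₂ _<_ (entry-++ˡ A B p≤|A|) (entry-++ʳ A B (proj₁ ir′)) πp<πr)
... | no _ | no p≰|A|
  with p′ , ip′ , refl ← split-IsIndex A B ip (≰⇒> p≰|A|)
  with q′ , iq′ , refl ← split-IsIndex A B iq (<-trans (≰⇒> p≰|A|) p<q)
  with r′ , ir′ , refl ← split-IsIndex A B ir (<-trans (<-trans (≰⇒> p≰|A|) p<q) q<r) =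
  B-free ( +-cancelˡ-< (length A) p′ q′ p<q , +-cancelˡ-< (length A) q′ r′ q<r
         , subst₂ _<_ (entry-++ʳ A B (proj₁ iq′)) (entry-++ʳ A B (proj₁ ip′)) πq<πp
         , subst₂ _<_ (entry-++ʳ A B (proj₁ ip′)) (entry-++ʳ A B (proj₁ ir′)) πp<πr)

NoHead213-++ : ∀ {x} A B → (∀ {u} → u ∈ A → x < u) → (∀ {v} → v ∈ B → v < x) → NoHead213 x (A ++ B)
NoHead213-++ {x} A B x<A B<x {q} {r} 1≤q q<r (πq<x , x<πr) with q ≤? length A
... | yes q≤|A| = <-asym πq<x (subst (x <_) (sym (entry-++ˡ A B q≤|A|)) (x<A (entry-∈ A (1≤q , q≤|A|))))
... | no q≰|A|
  with r′ , ir′ , refl ← split-IsIndex A B (entry>0⇒IsIndex (A ++ B) (≤-trans (s≤s z≤n) x<πr))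
                                           (<-trans (≰⇒> q≰|A|) q<r) =
  <-asym x<πr (subst (_< x) (sym (entry-++ʳ A B (proj₁ ir′))) (B<x (entry-∈ B ir′)))

Avoids213⇒No213 : ∀ {n} π → length π ≡ n → Avoids213 n π → No213 π
Avoids213⇒No213 π refl avoids pat
  with (1≤p , p≤) , (1≤q , q≤) , (1≤r , r≤) ← Pattern213At-IsIndex π pat =
  All.lookup avoids (∈-concatMap⁺ _ (lose (∈-range⁺ 1≤p p≤)
                     (∈-concatMap⁺ _ (lose (∈-range⁺ 1≤q q≤) (∈-map⁺ _ (∈-range⁺ 1≤r r≤)))))) pat

No213⇒Avoids213 : ∀ n π → No213 π → Avoids213 n π
No213⇒Avoids213 n π free = All.tabulate λ _ → free

-- In a 213-avoider starting with j+1, all larger entries precede all smaller ones.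
glue : ℕ → List ℕ → List ℕ → List ℕ
glue j a b = suc j ∷ (map (_+ suc j) a ++ b)

glue-InAv213 : ∀ {n j a b} → j ≤ n → InAv213 (n ∸ j) a → InAv213 j b → InAv213 (suc n) (glue j a b)
glue-InAv213 {n} {j} {a} {b} j≤n ((|a| , a-letters , !a) , a-avoids) ((|b| , b-letters , !b) , b-avoids) =
  (cong suc |a′++b| , (x-letter ∷ All.++⁺ a′-letters b-letters′) , (x∉ ∷ !a′++b)) ,
  No213⇒Avoids213 (suc n) (glue j a b) glue-free
  where
  x  = suc j
  a′ = map (_+ x) a
  x<a′ : ∀ {u} → u ∈ a′ → x < u
  x<a′ u∈ with v , v∈ , refl ← ∈-map⁻ (_+ x) u∈ = +-monoˡ-< x (proj₁ (All.lookup a-letters v∈))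
  b<x : ∀ {v} → v ∈ b → v < x
  b<x v∈ = s≤s (proj₂ (All.lookup b-letters v∈))
  |a′++b| : length (a′ ++ b) ≡ n
  |a′++b| = begin
    length (a′ ++ b)        ≡⟨ List.length-++ a′ ⟩
    length a′ + length b    ≡⟨ cong₂ _+_ (trans (List.length-map (_+ x) a) |a|) |b| ⟩
    n ∸ j + j               ≡⟨ m∸n+n≡m j≤n ⟩
    n                       ∎
    where open ≡-Reasoning
  x-letter : 1 ≤ x × x ≤ suc n
  x-letter = s≤s z≤n , s≤s j≤n
  a′-letters : Letters (suc n) a′
  a′-letters = All.map⁺ (All.map (λ {v} (1≤v , v≤n∸j) →
    ≤-trans 1≤v (m≤m+n v x) ,
    subst (v + x ≤_) (trans (+-suc (n ∸ j) j) (cong suc (m∸n+n≡m j≤n))) (+-monoˡ-≤ x v≤n∸j)) a-letters)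
  b-letters′ : Letters (suc n) b
  b-letters′ = All.map (λ (1≤v , v≤j) → 1≤v , m≤n⇒m≤1+n (≤-trans v≤j j≤n)) b-letters
  x∉ : All (x ≢_) (a′ ++ b)
  x∉ = All.tabulate λ u∈ x≡u → [ <-irrefl x≡u ∘ x<a′ , <-irrefl (sym x≡u) ∘ b<x ] (∈-++⁻ a′ u∈)
  !a′++b : Unique (a′ ++ b)
  !a′++b = Unique.++⁺ (Unique.map⁺ (+-cancelʳ-≡ x _ _) !a) !b λ (u∈a′ , u∈b) → <-asym (x<a′ u∈a′) (b<x u∈b)
  glue-free : No213 (glue j a b)
  glue-free = No213-∷⁺ (No213-++⁺ a′ b (No213-map⁺ (_+ x) (+-cancelʳ-< x _ _) a (Avoids213⇒No213 a |a| a-avoids))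
                                       (Avoids213⇒No213 b |b| b-avoids) λ u∈ v∈ → <-trans (b<x v∈) (x<a′ u∈))
                       (NoHead213-++ a′ b x<a′ b<x)

Unique-++⁻ : ∀ (xs : List A) {ys} → Unique (xs ++ ys) → Unique xs × Unique ys
Unique-++⁻ []       !ys         = [] , !ys
Unique-++⁻ (x ∷ xs) (x∉ ∷ !xs++ys) with !xs , !ys ← Unique-++⁻ xs !xs++ys = (All.++⁻ˡ xs x∉ ∷ !xs) , !ys

No213-suffix-below : ∀ {x} A B → No213 (x ∷ (A ++ B)) → All (x ≢_) B →
                     Maybe.All (λ y → ¬ x < y) (head B) → All (_< x) B
No213-suffix-below A []       _    _         _             = []
No213-suffix-below {x} A (y ∷ B) free (x≢y ∷ x∉B) (just x≮y) = y<x ∷ All.tabulate z<x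
  where
  y<x : y < x
  y<x = ≤∧≢⇒< (≮⇒≥ x≮y) (x≢y ∘ sym)
  z<x : ∀ {z} → z ∈ B → z < x
  z<x {z} z∈ with x <? z
  ... | no x≮z = ≤∧≢⇒< (≮⇒≥ x≮z) (λ z≡x → All.lookup x∉B z∈ (sym z≡x))
  ... | yes x<z with i , (1≤i , _) , refl ← ∈⇒entry z∈ =
    ⊥-elim (No213⇒NoHead213 free {q = length A + 1} {r = length A + suc i}
             (≤-trans (s≤s z≤n) (m≤n+m 1 (length A))) (+-monoʳ-< (length A) (s≤s 1≤i))
             (subst (_< x) (sym (entry-++ʳ A (y ∷ B) (s≤s z≤n))) y<x ,
              subst (x <_) (sym (trans (entry-++ʳ A (y ∷ B) (s≤s z≤n)) (entry-∷ y B 1≤i))) x<z))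

bounded-+-≡ : ∀ {m n o p} → m ≤ n → o ≤ p → m + o ≡ n + p → m ≡ n × o ≡ p
bounded-+-≡ {m} {n} {o} {p} m≤n o≤p m+o≡n+p = m≡n , +-cancelˡ-≡ n o p (trans (cong (_+ o) (sym m≡n)) m+o≡n+p)
  where
  m≡n : m ≡ n
  m≡n = ≤-antisym m≤n (≮⇒≥ λ m<n → <-irrefl m+o≡n+p (+-mono-<-≤ m<n o≤p))

length-Letters : ∀ {n xs} → Unique xs → Letters n xs → length xs ≤ n
length-Letters {n} !xs letters = subst (_ ≤_) (length-range n)
  (length-Unique-⊆ !xs λ v∈ → let 1≤v , v≤n = All.lookup letters v∈ in ∈-range⁺ 1≤v v≤n)

record Glued (n : ℕ) (π : List ℕ) : Set where
  constructor glued
  field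
    j   : ℕ
    j≤n : j ≤ n
    a b : List ℕ
    a∈  : InAv213 (n ∸ j) a
    b∈  : InAv213 j b
    π≡  : π ≡ glue j a b

No213-∷-split : ∀ {x} R → No213 (x ∷ R) → All (x ≢_) R →
                ∃ λ a → ∃ λ b → R ≡ map (_+ x) a ++ b × All (_< x) b
No213-∷-split {x} R free x∉R = map (_∸ x) above , below , R≡ , below<x
  where
  above = takeWhile (x <?_) R
  below = dropWhile (x <?_) R
  above++below≡R : above ++ below ≡ R
  above++below≡R = List.takeWhile++dropWhile (x <?_) R
  R≡ : R ≡ map (_+ x) (map (_∸ x) above) ++ below
  R≡ = sym (trans (cong (_++ below) (trans (sym (List.map-∘ above)) (List.map-id-local
                    (All.map (λ x<v → m∸n+n≡m (<⇒≤ x<v)) (All.all-takeWhile (x <?_) R)))))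
                  above++below≡R)
  below<x : All (_< x) below
  below<x = No213-suffix-below above below (subst (λ R → No213 (x ∷ R)) (sym above++below≡R) free)
                               (All.++⁻ʳ above (subst (All (x ≢_)) (sym above++below≡R) x∉R))
                               (All.all-head-dropWhile (x <?_) R)

glue-InAv213⁻ : ∀ {n j a b} → All (_< suc j) b → InAv213 (suc n) (glue j a b) →
                j ≤ n × InAv213 (n ∸ j) a × InAv213 j b
glue-InAv213⁻ {n} {j} {a} {b} b<x ((|π| , ((_ , s≤s j≤n) ∷ rest-letters) , (x∉ ∷ !rest)) , avoids) =
  j≤n , ((proj₁ |a|×|b| , a-letters , !a) , No213⇒Avoids213 (n ∸ j) a a-free)
      , ((proj₂ |a|×|b| , b-letters , !b) , No213⇒Avoids213 j b b-free)
  where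
  x  = suc j
  a′ = map (_+ x) a
  !a′×!b : Unique a′ × Unique b
  !a′×!b = Unique-++⁻ a′ !rest
  !a : Unique a
  !a = Unique.map⁻ (proj₁ !a′×!b)
  !b : Unique b
  !b = proj₂ !a′×!b
  a-letters : Letters (n ∸ j) a
  a-letters = All.tabulate λ {v} v∈ →
    let v+x∈ = ∈-++⁺ˡ (∈-map⁺ (_+ x) v∈)
        1≤v  = n≢0⇒n>0 λ { refl → All.lookup x∉ v+x∈ refl }
    in 1≤v , subst (_≤ n ∸ j) (m+n∸n≡m v x) (∸-monoˡ-≤ x (proj₂ (All.lookup rest-letters v+x∈)))
  b-letters : Letters j b
  b-letters = All.tabulate λ v∈ → proj₁ (All.lookup rest-letters (∈-++⁺ʳ a′ v∈)) , ≤-pred (All.lookup b<x v∈)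
  |a|+|b| : length a + length b ≡ n ∸ j + j
  |a|+|b| = begin
    length a + length b    ≡⟨ cong (_+ length b) (List.length-map (_+ x) a) ⟨
    length a′ + length b   ≡⟨ List.length-++ a′ ⟨
    length (a′ ++ b)       ≡⟨ suc-injective |π| ⟩
    n                      ≡⟨ m∸n+n≡m j≤n ⟨
    n ∸ j + j              ∎
    where open ≡-Reasoning
  |a|×|b| : length a ≡ n ∸ j × length b ≡ j
  |a|×|b| = bounded-+-≡ (length-Letters !a a-letters) (length-Letters !b b-letters) |a|+|b|
  a′b-free : No213 (a′ ++ b)
  a′b-free = No213-∷⁻ (Avoids213⇒No213 (glue j a b) |π| avoids)
  a-free : No213 a
  a-free = No213-map⁻ (_+ x) (+-monoˡ-< x) a (No213-++⁻ˡ a′ b a′b-free)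
  b-free : No213 b
  b-free = No213-++⁻ʳ a′ b a′b-free

InAv213⇒Glued : ∀ {n π} → InAv213 (suc n) π → Glued n π
InAv213⇒Glued {n} {[]}        ((() , _) , _)
InAv213⇒Glued {n} {zero ∷ R}  ((_ , ((() , _) ∷ _) , _) , _)
InAv213⇒Glued {n} {suc j ∷ R} π∈@((|π| , _ , (x∉R ∷ _)) , avoids)
  with a , b , refl , b<x ← No213-∷-split R (Avoids213⇒No213 (suc j ∷ R) |π| avoids) x∉R
  with j≤n , a∈ , b∈ ← glue-InAv213⁻ b<x π∈ = glued j j≤n a b a∈ b∈ refl

glued213 : ℕ → ℕ → List (List ℕ)
glued213 n j = concatMap (λ a → map (glue j a) (Av213 j)) (Av213 (n ∸ j))

take-length-++ : ∀ (xs : List A) {ys} → take (length xs) (xs ++ ys) ≡ xs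
take-length-++ []       = refl
take-length-++ (x ∷ xs) = cong (x ∷_) (take-length-++ xs)

glued213-Unique : ∀ n j → Unique (glued213 n j)
glued213-Unique n j =
  concatMap-Unique (λ a → map (glue j a) (Av213 j)) unglueˡ (Av213-Unique (n ∸ j))
    (λ _ → Unique.map⁺ (λ eq → List.++-cancelˡ _ _ _ (List.∷-injectiveʳ eq)) (Av213-Unique j))
    λ a∈ π∈ → unglueˡ-glue (proj₁ (proj₁ (∈-Av213⁻ a∈))) π∈
  where
  unglueˡ : List ℕ → List ℕ
  unglueˡ π = map (_∸ suc j) (take (n ∸ j) (drop 1 π))
  unglueˡ-glue : ∀ {a π} → length a ≡ n ∸ j → π ∈ map (glue j a) (Av213 j) → unglueˡ π ≡ a
  unglueˡ-glue {a} |a| π∈ with b , _ , refl ← ∈-map⁻ (glue j a) π∈ = begin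
    map (_∸ suc j) (take (n ∸ j) (map (_+ suc j) a ++ b))
      ≡⟨ cong (λ k → map (_∸ suc j) (take k (map (_+ suc j) a ++ b))) (trans (List.length-map (_+ suc j) a) |a|) ⟨
    map (_∸ suc j) (take (length (map (_+ suc j) a)) (map (_+ suc j) a ++ b))
      ≡⟨ cong (map (_∸ suc j)) (take-length-++ (map (_+ suc j) a)) ⟩
    map (_∸ suc j) (map (_+ suc j) a)
      ≡⟨ List.map-∘ a ⟨
    map (λ v → v + suc j ∸ suc j) a
      ≡⟨ List.map-id-local (All.tabulate λ {v} _ → m+n∸n≡m v (suc j)) ⟩
    a ∎
    where open ≡-Reasoning

∈-Av213-suc : ∀ n {π} → π ∈ Av213 (suc n) ⇔ π ∈ concatMap (glued213 n) (upTo (suc n))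
∈-Av213-suc n = mk⇔ glued∈ ∈glued
  where
  glued∈ : ∀ {π} → π ∈ Av213 (suc n) → π ∈ concatMap (glued213 n) (upTo (suc n))
  glued∈ π∈ with glued j j≤n a b a∈ b∈ refl ← InAv213⇒Glued {n} (∈-Av213⁻ π∈) =
    ∈-concatMap⁺ (glued213 n) (lose (∈-upTo⁺ (s≤s j≤n))
      (∈-concatMap⁺ (λ a → map (glue j a) (Av213 j)) (lose (∈-Av213⁺ a∈) (∈-map⁺ (glue j a) (∈-Av213⁺ b∈)))))
  ∈glued : ∀ {π} → π ∈ concatMap (glued213 n) (upTo (suc n)) → π ∈ Av213 (suc n)
  ∈glued π∈
    with j , j∈ , π∈j ← find (∈-concatMap⁻ (glued213 n) {xs = upTo (suc n)} π∈)
    with a , a∈ , π∈ja ← find (∈-concatMap⁻ (λ a → map (glue j a) (Av213 j)) {xs = Av213 (n ∸ j)} π∈j)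
    with b , b∈ , refl ← ∈-map⁻ (glue j a) π∈ja =
    ∈-Av213⁺ (glue-InAv213 (≤-pred (∈-upTo⁻ j∈)) (∈-Av213⁻ a∈) (∈-Av213⁻ b∈))

∑glue : ℕ → ℕ → (List ℕ → ℕ) → ℕ
∑glue n j f = sum (map (λ a → sum (map (λ b → f (glue j a b)) (Av213 j))) (Av213 (n ∸ j)))

sum-Av213-suc : ∀ n (f : List ℕ → ℕ) → sum (map f (Av213 (suc n))) ≡ ∑< (suc n) (λ j → ∑glue n j f)
sum-Av213-suc n f = begin
  sum (map f (Av213 (suc n)))
    ≡⟨ sum-Unique-sameMembers f (Av213-Unique (suc n))
         (concatMap-Unique (glued213 n) (λ π → entry π 1 ∸ 1) (Unique.upTo⁺ (suc n))
            (λ {j} _ → glued213-Unique n j) λ {j} _ → head-glued213 j)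
         (∈-Av213-suc n) ⟩
  sum (map f (concatMap (glued213 n) (upTo (suc n))))
    ≡⟨ sum-concatMap f (glued213 n) (upTo (suc n)) ⟩
  sum (map (λ j → sum (map f (glued213 n j))) (upTo (suc n)))
    ≡⟨ sum-cong (upTo (suc n)) (λ {j} _ →
         trans (sum-concatMap f _ (Av213 (n ∸ j))) (sum-cong (Av213 (n ∸ j)) λ {a} _ → sum-map-∘ f (glue j a) (Av213 j))) ⟩
  sum (map (λ j → ∑glue n j f) (upTo (suc n)))
    ≡⟨ sum-upTo (suc n) (λ j → ∑glue n j f) ⟩
  ∑< (suc n) (λ j → ∑glue n j f) ∎
  where
  open ≡-Reasoning
  head-glued213 : ∀ j {π} → π ∈ glued213 n j → entry π 1 ∸ 1 ≡ j
  head-glued213 j π∈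
    with a , _ , π∈a ← find (∈-concatMap⁻ (λ a → map (glue j a) (Av213 j)) {xs = Av213 (n ∸ j)} π∈)
    with _ , _ , refl ← ∈-map⁻ (glue j a) π∈a = refl

#Av213 : ℕ → ℕ
#Av213 n = length (Av213 n)

∑glue-const : ∀ n j (f : List ℕ → ℕ) c → (∀ {a b} → InAv213 (n ∸ j) a → InAv213 j b → f (glue j a b) ≡ c) →
              ∑glue n j f ≡ c * (#Av213 (n ∸ j) * #Av213 j)
∑glue-const n j f c f≡c = begin
  ∑glue n j f                                      ≡⟨ sum-cong (Av213 (n ∸ j)) (λ a∈ →
                                                        trans (sum-cong (Av213 j) λ b∈ → f≡c (∈-Av213⁻ a∈) (∈-Av213⁻ b∈))
                                                              (sum-const c (Av213 j))) ⟩
  sum (map (λ _ → c * #Av213 j) (Av213 (n ∸ j)))   ≡⟨ sum-const (c * #Av213 j) (Av213 (n ∸ j)) ⟩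
  c * #Av213 j * #Av213 (n ∸ j)                    ≡⟨ *-assoc c (#Av213 j) _ ⟩
  c * (#Av213 j * #Av213 (n ∸ j))                  ≡⟨ cong (c *_) (*-comm (#Av213 j) _) ⟩
  c * (#Av213 (n ∸ j) * #Av213 j)                  ∎
  where open ≡-Reasoning

∑glue-suffix : ∀ n j (f g : List ℕ → ℕ) →
               (∀ {a b} → InAv213 (n ∸ j) a → InAv213 j b → f (glue j a b) ≡ g b) →
               ∑glue n j f ≡ #Av213 (n ∸ j) * sum (map g (Av213 j))
∑glue-suffix n j f g f≡g =
  trans (sum-cong (Av213 (n ∸ j)) λ a∈ → sum-cong (Av213 j) λ b∈ → f≡g (∈-Av213⁻ a∈) (∈-Av213⁻ b∈))
        (trans (sum-const _ (Av213 (n ∸ j))) (*-comm _ (#Av213 (n ∸ j))))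

#Av213-suc : ∀ n → #Av213 (suc n) ≡ ∑< (suc n) (λ j → #Av213 (n ∸ j) * #Av213 j)
#Av213-suc n = begin
  #Av213 (suc n)                          ≡⟨ trans (sym (*-identityˡ _)) (sym (sum-const 1 (Av213 (suc n)))) ⟩
  sum (map (λ _ → 1) (Av213 (suc n)))     ≡⟨ sum-Av213-suc n (λ _ → 1) ⟩
  ∑< (suc n) (λ j → ∑glue n j (λ _ → 1))  ≡⟨ ∑<-cong (suc n) (λ j _ →
                                               trans (∑glue-const n j (λ _ → 1) 1 λ _ _ → refl) (*-identityˡ _)) ⟩
  ∑< (suc n) (λ j → #Av213 (n ∸ j) * #Av213 j) ∎
  where open ≡-Reasoning

#Av213≡Cat : ∀ n → #Av213 n ≡ Cat n
#Av213≡Cat = <-rec (λ n → #Av213 n ≡ Cat n) step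
  where
  step : ∀ n → (∀ {m} → m < n → #Av213 m ≡ Cat m) → #Av213 n ≡ Cat n
  step zero    _  = refl
  step (suc n) ih = begin
    #Av213 (suc n)                                ≡⟨ #Av213-suc n ⟩
    ∑< (suc n) (λ j → #Av213 (n ∸ j) * #Av213 j)  ≡⟨ ∑<-cong (suc n) (λ j j<1+n →
                                                     trans (cong₂ _*_ (ih (s≤s (m∸n≤m n j))) (ih j<1+n))
                                                           (*-comm (Cat (n ∸ j)) (Cat j))) ⟩
    ∑< (suc n) (λ j → Cat j * Cat (n ∸ j))        ≡⟨ Cat-suc n ⟨
    Cat (suc n)                                   ∎
    where open ≡-Reasoning

endLeaves : List ℕ → ℕ → ℕ → ℕ
endLeaves π c o = 𝟙 (entry π c ≟ 1) + 𝟙 (entry π o <? entry π c)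

glue-endLeaves-1-2 : ∀ {n j a b} → j ≤ n → InAv213 (n ∸ j) a → InAv213 j b →
                     endLeaves (glue j a b) 1 2 ≡ 𝟙 (j ≟ 0) + 𝟙 (j ≟ n)
glue-endLeaves-1-2 {n} {j} {a} {b} j≤n ((|a| , _) , _) ((_ , b-letters , _) , _) =
  cong₂ _+_ (𝟙-cong (suc j ≟ 1) (j ≟ 0) suc-injective (cong suc)) (second-below a |a|)
  where
  second-below : ∀ a → length a ≡ n ∸ j → 𝟙 (entry (map (_+ suc j) a ++ b) 1 <? suc j) ≡ 𝟙 (j ≟ n)
  second-below []      |a| = trans (𝟙-yes (entry b 1 <? suc j) (b₁<1+j b b-letters))
                                   (sym (𝟙-yes (j ≟ n) (≤-antisym j≤n (m∸n≡0⇒m≤n (sym |a|)))))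
    where
    b₁<1+j : ∀ b → Letters j b → entry b 1 < suc j
    b₁<1+j []      _               = s≤s z≤n
    b₁<1+j (v ∷ _) ((_ , v≤j) ∷ _) = s≤s v≤j
  second-below (v ∷ _) |a| = trans (𝟙-no (v + suc j <? suc j) (m+n≮n v (suc j)))
                                   (sym (𝟙-no (j ≟ n) λ { refl → 0≢1+n (trans (sym (n∸n≡0 j)) (sym |a|)) }))

sum-endLeaves-1-2 : ∀ n → sum (map (λ π → endLeaves π 1 2) (Av213 (suc n))) ≡ #Av213 n + #Av213 n
sum-endLeaves-1-2 n = begin
  sum (map (λ π → endLeaves π 1 2) (Av213 (suc n)))
    ≡⟨ sum-Av213-suc n (λ π → endLeaves π 1 2) ⟩
  ∑< (suc n) (λ j → ∑glue n j (λ π → endLeaves π 1 2))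
    ≡⟨ ∑<-cong (suc n) (λ j j<1+n →
         trans (∑glue-const n j (λ π → endLeaves π 1 2) _ (glue-endLeaves-1-2 (≤-pred j<1+n)))
               (*-distribʳ-+ (g j) (𝟙 (j ≟ 0)) (𝟙 (j ≟ n)))) ⟩
  ∑< (suc n) (λ j → 𝟙 (j ≟ 0) * g j + 𝟙 (j ≟ n) * g j)
    ≡⟨ ∑<-+ (suc n) _ _ ⟩
  ∑< (suc n) (λ j → 𝟙 (j ≟ 0) * g j) + ∑< (suc n) (λ j → 𝟙 (j ≟ n) * g j)
    ≡⟨ cong₂ _+_ (∑<-δ (suc n) g (s≤s z≤n)) (∑<-δ (suc n) g ≤-refl) ⟩
  #Av213 n * 1 + #Av213 (n ∸ n) * #Av213 n
    ≡⟨ cong₂ _+_ (*-identityʳ (#Av213 n))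
                 (trans (cong (λ k → #Av213 k * #Av213 n) (n∸n≡0 n)) (*-identityˡ (#Av213 n))) ⟩
  #Av213 n + #Av213 n ∎
  where
  open ≡-Reasoning
  g : ℕ → ℕ
  g j = #Av213 (n ∸ j) * #Av213 j

glue-entry-prefix : ∀ j a b {i} → i ≤ length a → entry (glue j a b) (suc i) ≡ entry a i + suc j
glue-entry-prefix j a b {zero}  _     = cong (_+ suc j) (sym (entry-0 a))
glue-entry-prefix j a b {suc i} i<|a| = trans (entry-++ˡ (map (_+ suc j) a) b (subst (suc i ≤_) (sym (List.length-map _ a)) i<|a|))
                                              (entry-map (_+ suc j) a (s≤s z≤n , i<|a|))

glue-entry-suffix : ∀ j a b {i} → 1 ≤ i → entry (glue j a b) (suc (length a + i)) ≡ entry b i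
glue-entry-suffix j a b {i} 1≤i = begin
  entry (glue j a b) (suc (length a + i))          ≡⟨ entry-∷ (suc j) _ (≤-trans 1≤i (m≤n+m i (length a))) ⟩
  entry (a′ ++ b) (length a + i)                   ≡⟨ cong (λ k → entry (a′ ++ b) (k + i)) (List.length-map (_+ suc j) a) ⟨
  entry (a′ ++ b) (length a′ + i)                  ≡⟨ entry-++ʳ a′ b 1≤i ⟩
  entry b i                                        ∎
  where
  open ≡-Reasoning
  a′ = map (_+ suc j) a

InAv213-0 : ∀ {b} → InAv213 0 b → b ≡ []
InAv213-0 {[]} _ = refl

InAv213-1 : ∀ {b} → InAv213 1 b → b ≡ 1 ∷ []
InAv213-1 {v ∷ []} ((_ , ((1≤v , v≤1) ∷ []) , _) , _) = cong (_∷ []) (≤-antisym v≤1 1≤v)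

∑glue-0 : ∀ n (f : List ℕ → ℕ) → ∑glue n 0 f ≡ sum (map (λ a → f (glue 0 a [])) (Av213 n))
∑glue-0 n f = sum-cong (Av213 n) λ {a} _ → +-identityʳ (f (glue 0 a []))

glue-entry-last : ∀ n i j a b → length a ≡ n ∸ i → i ≤ n → 1 ≤ i → entry (glue j a b) (suc n) ≡ entry b i
glue-entry-last n i j a b |a| i≤n 1≤i = begin
  entry (glue j a b) (suc n)               ≡⟨ cong (λ l → entry (glue j a b) (suc l)) (m∸n+n≡m i≤n) ⟨
  entry (glue j a b) (suc (n ∸ i + i))     ≡⟨ cong (λ l → entry (glue j a b) (suc (l + i))) |a| ⟨
  entry (glue j a b) (suc (length a + i))  ≡⟨ glue-entry-suffix j a b 1≤i ⟩
  entry b i                                ∎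
  where open ≡-Reasoning

isOneAt : ℕ → List ℕ → ℕ
isOneAt i π = 𝟙 (entry π i ≟ 1)

glue-0-isOneAt : ∀ {m a} → IsPerm (suc m) a → isOneAt (2 + m) (glue 0 a []) ≡ 0
glue-0-isOneAt {m} {a} (|a| , letters , _) = 𝟙-no (entry (glue 0 a []) (2 + m) ≟ 1) λ last≡1 →
  <-irrefl (trans (sym last≡1) (glue-entry-prefix 0 a [] 1+m≤|a|))
           (+-monoˡ-< 1 (proj₁ (All.lookup letters (entry-∈ a (s≤s z≤n , 1+m≤|a|)))))
  where 1+m≤|a| = ≤-reflexive (sym |a|)

glue-suffix-isOneAt : ∀ {m k} a b → length a ≡ m ∸ k → k ≤ m → isOneAt (2 + m) (glue (suc k) a b) ≡ isOneAt (suc k) b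
glue-suffix-isOneAt {m} {k} a b |a| k≤m =
  cong (λ e → 𝟙 (e ≟ 1)) (glue-entry-last (suc m) (suc k) (suc k) a b |a| (s≤s k≤m) (s≤s z≤n))

sum-isOneAt-last : ∀ n → sum (map (isOneAt (suc n)) (Av213 (suc n))) ≡ #Av213 n
sum-isOneAt-last = <-rec _ step
  where
  step : ∀ n → (∀ {m} → m < n → sum (map (isOneAt (suc m)) (Av213 (suc m))) ≡ #Av213 m) →
         sum (map (isOneAt (suc n)) (Av213 (suc n))) ≡ #Av213 n
  step zero    _  = refl
  step (suc m) ih = begin
    sum (map (isOneAt (2 + m)) (Av213 (2 + m)))   ≡⟨ sum-Av213-suc (suc m) (isOneAt (2 + m)) ⟩
    ∑< (2 + m) term                               ≡⟨ ∑<-front (suc m) term ⟩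
    term 0 + ∑< (suc m) (term ∘ suc)              ≡⟨ cong₂ _+_ term0 (∑<-cong (suc m) term1+k) ⟩
    ∑< (suc m) (λ k → #Av213 (m ∸ k) * #Av213 k)  ≡⟨ #Av213-suc m ⟨
    #Av213 (suc m)                                ∎
    where
    open ≡-Reasoning
    term : ℕ → ℕ
    term j = ∑glue (suc m) j (isOneAt (2 + m))
    term0 : term 0 ≡ 0
    term0 = ∑glue-const (suc m) 0 (isOneAt (2 + m)) 0 λ {a} (a-perm , _) b∈ →
      subst (λ b → isOneAt (2 + m) (glue 0 a b) ≡ 0) (sym (InAv213-0 b∈)) (glue-0-isOneAt a-perm)
    term1+k : ∀ k → k < suc m → term (suc k) ≡ #Av213 (m ∸ k) * #Av213 k
    term1+k k k<1+m =
      trans (∑glue-suffix (suc m) (suc k) (isOneAt (2 + m)) (isOneAt (suc k))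
               λ {a} {b} ((|a| , _) , _) _ → glue-suffix-isOneAt a b |a| (≤-pred k<1+m))
            (cong (#Av213 (m ∸ k) *_) (ih k<1+m))

-- Since entry π 0 = 0, ascentAt 0 is 1 on every nonempty π; this makes the base case of
-- sum-ascentAt-last and the case m = 0 of glue-0-ascentAt hold.
ascentAt : ℕ → List ℕ → ℕ
ascentAt i π = 𝟙 (entry π i <? entry π (suc i))

glue-0-ascentAt : ∀ {m a} → length a ≡ suc m → ascentAt (suc m) (glue 0 a []) ≡ ascentAt m a
glue-0-ascentAt {m} {a} |a| =
  trans (cong₂ (λ u v → 𝟙 (u <? v)) (glue-entry-prefix 0 a [] (≤-trans (n≤1+n m) (≤-reflexive (sym |a|))))
                                    (glue-entry-prefix 0 a [] (≤-reflexive (sym |a|))))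
        (𝟙-cong (_ <? _) (_ <? _) (+-cancelʳ-< 1 _ _) (+-monoˡ-< 1))

glue-1-ascentAt : ∀ {m a} → length a ≡ m → ascentAt (suc m) (glue 1 a (1 ∷ [])) ≡ 0
glue-1-ascentAt {m} {a} |a| = 𝟙-no (entry π (suc m) <? entry π (2 + m)) λ lt →
  m+n≮n (entry a m) 2 (<-trans (subst₂ _<_ penultimate last lt) (n<1+n 1))
  where
  π = glue 1 a (1 ∷ [])
  penultimate : entry π (suc m) ≡ entry a m + 2
  penultimate = glue-entry-prefix 1 a (1 ∷ []) (≤-reflexive (sym |a|))
  last : entry π (2 + m) ≡ 1
  last = glue-entry-last (suc m) 1 1 a (1 ∷ []) |a| (s≤s z≤n) ≤-refl

glue-suffix-ascentAt : ∀ {m k} a b → length a ≡ m ∸ suc k → k < m →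
                       ascentAt (suc m) (glue (2 + k) a b) ≡ ascentAt (suc k) b
glue-suffix-ascentAt {m} {k} a b |a| k<m = cong₂ (λ u v → 𝟙 (u <? v))
  (glue-entry-last m (suc k) (2 + k) a b |a| k<m (s≤s z≤n))
  (glue-entry-last (suc m) (2 + k) (2 + k) a b |a| (s≤s k<m) (s≤s z≤n))

sum-ascentAt-last : ∀ n → sum (map (ascentAt n) (Av213 (suc n))) ≡ #Av213 n
sum-ascentAt-last = <-rec _ step
  where
  step : ∀ n → (∀ {m} → m < n → sum (map (ascentAt m) (Av213 (suc m))) ≡ #Av213 m) →
         sum (map (ascentAt n) (Av213 (suc n))) ≡ #Av213 n
  step zero    _  = refl
  step (suc m) ih = begin
    sum (map (ascentAt (suc m)) (Av213 (2 + m)))          ≡⟨ sum-Av213-suc (suc m) (ascentAt (suc m)) ⟩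
    ∑< (2 + m) term                                       ≡⟨ ∑<-front (suc m) term ⟩
    term 0 + ∑< (suc m) (term ∘ suc)                      ≡⟨ cong (term 0 +_) (∑<-front m (term ∘ suc)) ⟩
    term 0 + (term 1 + ∑< m (term ∘ suc ∘ suc))           ≡⟨ cong₂ _+_ term0 (cong₂ _+_ term1 (∑<-cong m term2+k)) ⟩
    #Av213 m + ∑< m (λ k → g (suc k))                     ≡⟨ cong (_+ ∑< m (λ k → g (suc k))) (*-identityʳ (#Av213 m)) ⟨
    g 0 + ∑< m (λ k → g (suc k))                          ≡⟨ ∑<-front m g ⟨
    ∑< (suc m) g                                          ≡⟨ #Av213-suc m ⟨
    #Av213 (suc m)                                        ∎
    where
    open ≡-Reasoning
    term g : ℕ → ℕ
    term j = ∑glue (suc m) j (ascentAt (suc m))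
    g    j = #Av213 (m ∸ j) * #Av213 j
    term0 : term 0 ≡ #Av213 m
    term0 = begin
      term 0                                                             ≡⟨ ∑glue-0 (suc m) (ascentAt (suc m)) ⟩
      sum (map (λ a → ascentAt (suc m) (glue 0 a [])) (Av213 (suc m)))   ≡⟨ sum-cong (Av213 (suc m)) (λ {a} a∈ →
                                                                              glue-0-ascentAt {m} {a} (proj₁ (proj₁ (∈-Av213⁻ a∈)))) ⟩
      sum (map (ascentAt m) (Av213 (suc m)))                             ≡⟨ ih ≤-refl ⟩
      #Av213 m                                                           ∎
    term1 : term 1 ≡ 0
    term1 = ∑glue-const (suc m) 1 (ascentAt (suc m)) 0 λ {a} ((|a| , _) , _) b∈ →
      subst (λ b → ascentAt (suc m) (glue 1 a b) ≡ 0) (sym (InAv213-1 b∈)) (glue-1-ascentAt |a|)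
    term2+k : ∀ k → k < m → term (2 + k) ≡ g (suc k)
    term2+k k k<m =
      trans (∑glue-suffix (suc m) (2 + k) (ascentAt (suc m)) (ascentAt (suc k))
               λ {a} {b} ((|a| , _) , _) _ → glue-suffix-ascentAt a b |a| k<m)
            (cong (#Av213 (m ∸ suc k) *_) (ih (s≤s k<m)))

inColumn : {P : ℕ × ℕ → Set} → (∀ v → Dec (P v)) → List ℕ → ℕ → ℕ
inColumn P? π i = sum (map (λ j → 𝟙 (P? (i , j))) (range (entry π i)))

length-filter-vertices : ∀ {P : ℕ × ℕ → Set} (P? : ∀ v → Dec (P v)) n π →
                         length (filter P? (vertices n π)) ≡ sum (map (inColumn P? π) (range n))
length-filter-vertices P? n π = begin
  length (filter P? (vertices n π))                   ≡⟨ length-filter P? (vertices n π) ⟩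
  sum (map (𝟙 ∘ P?) (vertices n π))                   ≡⟨ sum-concatMap (𝟙 ∘ P?) (λ i → map (i ,_) (range (entry π i))) (range n) ⟩
  sum (map (λ i → sum (map (𝟙 ∘ P?) (map (i ,_) (range (entry π i))))) (range n))
                                                      ≡⟨ sum-cong (range n) (λ {i} _ → sum-map-∘ (𝟙 ∘ P?) (i ,_) (range (entry π i))) ⟩
  sum (map (inColumn P? π) (range n))                 ∎
  where open ≡-Reasoning

Dist1-irrefl : ∀ {a} → ¬ Dist1 a a
Dist1-irrefl (inj₁ 1+a≡a) = 1+n≢n 1+a≡a
Dist1-irrefl (inj₂ 1+a≡a) = 1+n≢n 1+a≡a

count-≡ : ∀ m t → 1 ≤ t → sum (map (λ j → 𝟙 (t ≟ j)) (range m)) ≡ 𝟙 (t ≤? m)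
count-≡ m t 1≤t with t ≤? m
... | yes t≤m = trans (sum-single (range m) (range-Unique m) (∈-range⁺ 1≤t t≤m) λ _ j≢t →
                        𝟙-no (t ≟ _) (j≢t ∘ sym))
                      (𝟙-yes (t ≟ t) refl)
... | no t≰m  = sum-zero (range m) λ j∈ → 𝟙-no (t ≟ _) λ { refl → t≰m (proj₂ (∈-range⁻ j∈)) }

count-Dist1 : ∀ m j → 1 ≤ j → j ≤ m →
              sum (map (λ j′ → 𝟙 (dist1? j j′)) (range m)) ≡ 𝟙 (suc j ≤? m) + 𝟙 (2 ≤? j)
count-Dist1 m j 1≤j j≤m = begin
  sum (map (λ j′ → 𝟙 (dist1? j j′)) (range m))
    ≡⟨ sum-cong (range m) (λ {j′} _ → 𝟙-⊎ (suc j ≟ j′) (suc j′ ≟ j)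
         λ { refl 2+j≡j → <-irrefl (sym 2+j≡j) (m<n⇒m<1+n (n<1+n j)) }) ⟩
  sum (map (λ j′ → 𝟙 (suc j ≟ j′) + 𝟙 (suc j′ ≟ j)) (range m))
    ≡⟨ sum-+ (λ j′ → 𝟙 (suc j ≟ j′)) (λ j′ → 𝟙 (suc j′ ≟ j)) (range m) ⟩
  sum (map (λ j′ → 𝟙 (suc j ≟ j′)) (range m)) + sum (map (λ j′ → 𝟙 (suc j′ ≟ j)) (range m))
    ≡⟨ cong₂ _+_ (count-≡ m (suc j) (s≤s z≤n)) (below j 1≤j j≤m) ⟩
  𝟙 (suc j ≤? m) + 𝟙 (2 ≤? j) ∎
  where
  open ≡-Reasoning
  below : ∀ j → 1 ≤ j → j ≤ m → sum (map (λ j′ → 𝟙 (suc j′ ≟ j)) (range m)) ≡ 𝟙 (2 ≤? j)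
  below (suc zero)    _ _   = sum-zero (range m) λ j′∈ → 𝟙-no (suc _ ≟ 1) λ 1+j′≡1 →
                                1+n≰n (≤-trans (proj₁ (∈-range⁻ j′∈)) (≤-reflexive (suc-injective 1+j′≡1)))
  below (suc (suc j)) _ j≤m = begin
    sum (map (λ j′ → 𝟙 (suc j′ ≟ suc (suc j))) (range m))
      ≡⟨ sum-cong (range m) (λ {j′} _ →
           𝟙-cong (suc j′ ≟ suc (suc j)) (suc j ≟ j′) (sym ∘ suc-injective) (cong suc ∘ sym)) ⟩
    sum (map (λ j′ → 𝟙 (suc j ≟ j′)) (range m))
      ≡⟨ count-≡ m (suc j) (s≤s z≤n) ⟩
    𝟙 (suc j ≤? m)
      ≡⟨ 𝟙-yes (suc j ≤? m) (≤-trans (n≤1+n (suc j)) j≤m) ⟩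
    1
      ≡⟨ 𝟙-yes (2 ≤? suc (suc j)) (s≤s (s≤s z≤n)) ⟨
    𝟙 (2 ≤? suc (suc j)) ∎

columnDegree : ℕ → ℕ → ℕ → ℕ
columnDegree m k j = 𝟙 (suc j ≤? m) + 𝟙 (2 ≤? j) + 𝟙 (j ≤? k)

record EndColumn (n c o : ℕ) : Set where
  field
    c∈        : c ∈ range n
    o∈        : o ∈ range n
    next      : Dist1 c o
    only-next : ∀ {i} → i ∈ range n → Dist1 c i → i ≡ o

degree-EndColumn : ∀ {n c o} → EndColumn n c o → ∀ π {j} → j ∈ range (entry π c) →
                   degree n π (c , j) ≡ columnDegree (entry π c) (entry π o) j
degree-EndColumn {n} {c} {o} end π {j} j∈ = begin
  degree n π (c , j)
    ≡⟨ length-filter-vertices (adjacent? (c , j)) n π ⟩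
  sum (map (inColumn (adjacent? (c , j)) π) (range n))
    ≡⟨ sum-pair (range n) (range-Unique n) c∈ o∈ c≢o not-adjacent ⟩
  inColumn (adjacent? (c , j)) π c + inColumn (adjacent? (c , j)) π o
    ≡⟨ cong₂ _+_ (sum-cong (range (entry π c)) λ {j′} _ →
                    𝟙-cong (adjacent? (c , j) (c , j′)) (dist1? j j′) same-column (λ d → inj₁ (refl , d)))
                 (sum-cong (range (entry π o)) λ {j′} _ →
                    𝟙-cong (adjacent? (c , j) (o , j′)) (j ≟ j′) next-column (λ e → inj₂ (next , e))) ⟩
  sum (map (λ j′ → 𝟙 (dist1? j j′)) (range (entry π c))) + sum (map (λ j′ → 𝟙 (j ≟ j′)) (range (entry π o)))
    ≡⟨ cong₂ _+_ (count-Dist1 (entry π c) j 1≤j j≤m) (count-≡ (entry π o) j 1≤j) ⟩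
  columnDegree (entry π c) (entry π o) j ∎
  where
  open ≡-Reasoning
  open EndColumn end
  1≤j = proj₁ (∈-range⁻ j∈)
  j≤m = proj₂ (∈-range⁻ j∈)
  c≢o : c ≢ o
  c≢o refl = Dist1-irrefl next
  same-column : ∀ {j′} → Adjacent (c , j) (c , j′) → Dist1 j j′
  same-column (inj₁ (_ , d)) = d
  same-column (inj₂ (d , _)) = ⊥-elim (Dist1-irrefl d)
  next-column : ∀ {j′} → Adjacent (c , j) (o , j′) → j ≡ j′
  next-column (inj₁ (c≡o , _)) = ⊥-elim (c≢o c≡o)
  next-column (inj₂ (_ , e))   = e
  not-adjacent : ∀ {i} → i ∈ range n → i ≢ c → i ≢ o → inColumn (adjacent? (c , j)) π i ≡ 0
  not-adjacent {i} i∈ i≢c i≢o = sum-zero (range (entry π i)) λ _ → 𝟙-no (adjacent? (c , j) (i , _))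
    λ { (inj₁ (c≡i , _)) → i≢c (sym c≡i) ; (inj₂ (d , _)) → i≢o (only-next i∈ d) }

columnDegree-below-top : ∀ {m k j} → 1 ≤ k → 1 ≤ j → j < m → 2 ≤ columnDegree m k j
columnDegree-below-top {m} {k} {suc zero}    1≤k _ 1<m
  rewrite 𝟙-yes (2 ≤? m) 1<m | 𝟙-yes (1 ≤? k) 1≤k = ≤-refl
columnDegree-below-top {m} {k} {suc (suc j)} _   _ j<m
  rewrite 𝟙-yes (3 + j ≤? m) j<m = s≤s (s≤s z≤n)

leaves-columnDegree : ∀ m k → 1 ≤ m → 1 ≤ k →
                      sum (map (λ j → 𝟙 (columnDegree m k j ≟ 1)) (range m)) ≡ 𝟙 (m ≟ 1) + 𝟙 (k <? m)
leaves-columnDegree m k 1≤m 1≤k =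
  trans (sum-single (range m) (range-Unique m) (∈-range⁺ 1≤m ≤-refl) λ j∈ j≢m →
           𝟙-no (columnDegree m k _ ≟ 1) λ deg≡1 → <-irrefl (sym deg≡1)
             (columnDegree-below-top 1≤k (proj₁ (∈-range⁻ j∈)) (≤∧≢⇒< (proj₂ (∈-range⁻ j∈)) j≢m)))
        (top m 1≤m)
  where
  top : ∀ m → 1 ≤ m → 𝟙 (columnDegree m k m ≟ 1) ≡ 𝟙 (m ≟ 1) + 𝟙 (k <? m)
  top (suc zero) _ rewrite 𝟙-yes (1 ≤? k) 1≤k | 𝟙-no (k <? 1) (λ k<1 → <-irrefl refl (<-≤-trans k<1 1≤k)) = refl
  top m@(suc (suc _)) _ rewrite 𝟙-no (suc m ≤? m) 1+n≰n with m ≤? k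
  ... | yes m≤k = sym (𝟙-no (k <? m) (≤⇒≯ m≤k))
  ... | no m≰k  = sym (𝟙-yes (k <? m) (≰⇒> m≰k))

extLeaves-EndColumn : ∀ {n c o} → EndColumn n c o → (c ≡ 1 ⊎ c ≡ n) →
                      ∀ π → 1 ≤ entry π c → 1 ≤ entry π o →
                      inColumn (extLeaf? n π) π c ≡ endLeaves π c o
extLeaves-EndColumn {n} {c} {o} end side π 1≤m 1≤k = begin
  inColumn (extLeaf? n π) π c
    ≡⟨ sum-cong (range (entry π c)) (λ {j} j∈ →
         trans (𝟙-cong (extLeaf? n π (c , j)) (degree n π (c , j) ≟ 1) proj₁ (_, side))
               (cong (λ d → 𝟙 (d ≟ 1)) (degree-EndColumn end π j∈))) ⟩
  sum (map (λ j → 𝟙 (columnDegree (entry π c) (entry π o) j ≟ 1)) (range (entry π c)))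
    ≡⟨ leaves-columnDegree (entry π c) (entry π o) 1≤m 1≤k ⟩
  endLeaves π c o ∎
  where open ≡-Reasoning

extLeaves-count : ∀ n π → 2 ≤ n → IsPerm n π →
                  length (filter (extLeaf? n π) (vertices n π)) ≡ endLeaves π 1 2 + endLeaves π n (n ∸ 1)
extLeaves-count (suc zero) _ (s≤s ()) _
extLeaves-count n@(suc (suc n′)) π _ (|π| , letters , _) = begin
  length (filter (extLeaf? n π) (vertices n π))
    ≡⟨ length-filter-vertices (extLeaf? n π) n π ⟩
  sum (map (inColumn (extLeaf? n π) π) (range n))
    ≡⟨ sum-pair (range n) (range-Unique n) 1∈ n∈ (λ ()) interior ⟩
  inColumn (extLeaf? n π) π 1 + inColumn (extLeaf? n π) π n
    ≡⟨ cong₂ _+_ (extLeaves-EndColumn first (inj₁ refl) π (height 1∈) (height 2∈))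
                 (extLeaves-EndColumn last (inj₂ refl) π (height n∈) (height n′∈)) ⟩
  endLeaves π 1 2 + endLeaves π n (suc n′) ∎
  where
  open ≡-Reasoning
  1∈ : 1 ∈ range n
  1∈ = ∈-range⁺ ≤-refl (s≤s z≤n)
  2∈ : 2 ∈ range n
  2∈ = ∈-range⁺ (s≤s z≤n) (s≤s (s≤s z≤n))
  n∈ : n ∈ range n
  n∈ = ∈-range⁺ (s≤s z≤n) ≤-refl
  n′∈ : suc n′ ∈ range n
  n′∈ = ∈-range⁺ (s≤s z≤n) (n≤1+n (suc n′))
  height : ∀ {i} → i ∈ range n → 1 ≤ entry π i
  height i∈ = let 1≤i , i≤n = ∈-range⁻ i∈ in
    proj₁ (All.lookup letters (entry-∈ π (1≤i , subst (_ ≤_) (sym |π|) i≤n)))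
  first : EndColumn n 1 2
  first = record
    { c∈ = 1∈ ; o∈ = 2∈ ; next = inj₁ refl
    ; only-next = λ { _ (inj₁ refl) → refl ; i∈ (inj₂ refl) → ⊥-elim (1+n≰n (proj₁ (∈-range⁻ i∈))) } }
  last : EndColumn n n (suc n′)
  last = record
    { c∈ = n∈ ; o∈ = n′∈ ; next = inj₂ refl
    ; only-next = λ { i∈ (inj₁ refl) → ⊥-elim (1+n≰n (proj₂ (∈-range⁻ i∈))) ; _ (inj₂ refl) → refl } }
  interior : ∀ {i} → i ∈ range n → i ≢ 1 → i ≢ n → inColumn (extLeaf? n π) π i ≡ 0
  interior {i} _ i≢1 i≢n = sum-zero (range (entry π i)) λ _ → 𝟙-no (extLeaf? n π _)
    λ { (_ , inj₁ i≡1) → i≢1 i≡1 ; (_ , inj₂ i≡n) → i≢n i≡n }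

lemma6p3 : (n : ℕ) → 2 ≤ n → Q1ext n ≡ 4 * catalan (n ∸ 1)
lemma6p3 (suc zero) (s≤s ())
lemma6p3 n@(suc (suc m)) 2≤n = begin
  Q1ext n
    ≡⟨ sum-cong (Av213 n) (λ π∈ → extLeaves-count n _ 2≤n (proj₁ (∈-Av213⁻ π∈))) ⟩
  sum (map (λ π → endLeaves π 1 2 + (isOneAt n π + ascentAt (suc m) π)) (Av213 n))
    ≡⟨ sum-+ (λ π → endLeaves π 1 2) (λ π → isOneAt n π + ascentAt (suc m) π) (Av213 n) ⟩
  sum (map (λ π → endLeaves π 1 2) (Av213 n)) + sum (map (λ π → isOneAt n π + ascentAt (suc m) π) (Av213 n))
    ≡⟨ cong (sum (map (λ π → endLeaves π 1 2) (Av213 n)) +_) (sum-+ (isOneAt n) (ascentAt (suc m)) (Av213 n)) ⟩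
  sum (map (λ π → endLeaves π 1 2) (Av213 n)) + (sum (map (isOneAt n) (Av213 n)) + sum (map (ascentAt (suc m)) (Av213 n)))
    ≡⟨ cong₂ _+_ (sum-endLeaves-1-2 (suc m)) (cong₂ _+_ (sum-isOneAt-last (suc m)) (sum-ascentAt-last (suc m))) ⟩
  (#Av213 (suc m) + #Av213 (suc m)) + (#Av213 (suc m) + #Av213 (suc m))
    ≡⟨ cong (λ c → (c + c) + (c + c)) (trans (#Av213≡Cat (suc m)) (sym (catalan≡Cat (suc m)))) ⟩
  (c + c) + (c + c)
    ≡⟨ trans (+-assoc c c (c + c)) (cong (λ x → c + (c + x)) (cong (c +_) (sym (+-identityʳ c)))) ⟩
  4 * c ∎
  where
  open ≡-Reasoning
  c = catalan (suc m)
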